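{- There exists a rich word $w$ with $|\mathrm{Alph}(w)|=3$ that cannot be eventually extended richly in $3$ ways; i.e., there is no finite word $u$ over $\mathrm{Alph}(w)$ such that $wu$ is rich and $wua$ is rich for all three letters $a\in\mathrm{Alph}(w)$.
   Context: A palindrome is a word equal to its reversal (the empty word is a palindrome). A finite word $w$ is rich if it has exactly $|w|+1$ distinct palindromic factors (counting the empty word). $\mathrm{Alph}(w)$ is the set of letters occurring in $w$. A rich word $x$ can be extended richly in $n$ ways if there exist $n$ distinct letters $a\in\mathrm{Alph}(x)$ with $xa$ rich; a rich word $w$ can be eventually extended richly in $n$ ways if there exists a finite word $u$ such that $wu$ is rich and can be extended richly in $n$ ways. -}

module Defs where

open import Data.Nat using (ℕ; _+_)
open import Data.Nat.Properties using (_≟_)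
open import Data.List using (List; _++_; reverse; length; deduplicate)
open import Data.List.Membership.Propositional using (_∈_)
open import Data.List.Relation.Unary.Unique.Propositional using (Unique)
open import Data.Product using (Σ; ∃; ∃-syntax; _×_)
open import Relation.Binary.PropositionalEquality using (_≡_)
open import Function.Bundles using (_⇔_)

Word : Set
Word = List ℕ

Factor : Word → Word → Set
Factor v w = ∃[ p ] ∃[ s ] (p ++ v ++ s ≡ w)

Palindrome : Word → Set
Palindrome v = reverse v ≡ v

-- w is rich: it has exactly |w| + 1 distinct palindromic factors
-- (the empty word included): there is a duplicate-free list enumerating
-- exactly the palindromic factors of w, of length |w| + 1.
Rich : Word → Set
Rich w = Σ (List Word) λ L →
  Unique L × (∀ v → (v ∈ L) ⇔ (Factor v w × Palindrome v)) × (length L ≡ length w + 1)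

Alph : Word → List ℕ
Alph w = deduplicate _≟_ w

-- Take w₀ = 00101102. Appending a letter l to a word x creates at most one new
-- palindromic factor v, necessarily a suffix of xl; since a word of length n has at
-- most n + 1 palindromic factors, xl is rich only if x is rich and such a v exists.
-- A factor f of xl absent from x is also a suffix, so either v is a suffix of f, or
-- v ends in f and, being a palindrome, begins with the reversal of f, which then
-- occurs in x. For the eight words 12, 21, 002, 200, 0011, 1100, 0102, 2010 (closed
-- under reversal, and all of whose palindromic suffixes occur in w₀) this shows that
-- no rich extension of w₀ contains any of them. For the last three letters s of a
-- rich extension x and a letter l, it forces v to be a suffix of sl unless the
-- reversal of sl occurs in x; checking the 27 possible s shows this fails for some l.
module Submission where

open import Defs

open import Data.Empty using (⊥-elim)
open import Data.List using (List; []; _∷_; _++_; [_]; length; reverse; filter; concatMap; inits; tails; initLast; _∷ʳ′_)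
open import Data.List.Membership.Propositional using (_∈_; lose)
open import Data.List.Membership.Propositional.Properties using (∈-filter⁺; ∈-filter⁻; ∈-map⁺; ∈-concatMap⁺)
open import Data.List.Properties
  using (∷-injective; ++-assoc; ++-identityʳ; ≡-dec; reverse-++; unfold-reverse; ∷ʳ-injectiveˡ; length-++)
import Data.List.Relation.Unary.All as All
open import Data.List.Relation.Unary.All using (All; []; _∷_; all?)
open import Data.List.Relation.Unary.All.Properties using (++⁺; ++⁻ʳ)
open import Data.List.Relation.Unary.Any using (Any; here; there; any?)
open import Data.List.Relation.Unary.AllPairs using (_∷_)
open import Data.List.Relation.Unary.Unique.Propositional using (Unique)
open import Data.List.Relation.Unary.Unique.Propositional.Properties using (filter⁺)
open import Data.List.Reverse using (Reverse; []; _∶_∶ʳ_; reverseView)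
open import Data.Nat using (ℕ; suc; _+_; _≤_; z≤n; s≤s)
open import Data.Nat.Properties
  using (_≟_; m≤n⇒m<n∨m≡n; <-irrefl; +-mono-<-≤; +-mono-≤; +-cancelˡ-≡; +-suc; module ≤-Reasoning)
open import Data.Product using (∃; ∃-syntax; _×_; _,_; proj₁; proj₂; map₂)
open import Data.Sum using (_⊎_; inj₁; inj₂)
open import Function.Bundles using (_⇔_; mk⇔; Equivalence)
open import Level using (0ℓ)
open import Relation.Binary.PropositionalEquality
  using (_≡_; refl; sym; trans; cong; subst; module ≡-Reasoning)
open import Relation.Nullary using (¬_; Dec; yes; no; ¬?)
open import Relation.Nullary.Decidable using (_×-dec_; _⊎-dec_; _→-dec_; from-yes)
open import Relation.Unary using (Pred; Decidable)
open import Relation.Unary.Properties using (∁?)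

open import Data.List.Membership.DecPropositional (≡-dec _≟_) using (_∈?_)
open import Data.List.Membership.DecPropositional _≟_ using () renaming (_∈?_ to _∈ℕ?_)
open import Data.List.Relation.Unary.Unique.DecPropositional (≡-dec _≟_) using (unique?)

length≤1-if-allEqual : ∀ {A : Set} {xs : List A} → Unique xs →
                       (∀ {a b} → a ∈ xs → b ∈ xs → a ≡ b) → length xs ≤ 1
length≤1-if-allEqual {xs = []} _ _ = z≤n
length≤1-if-allEqual {xs = _ ∷ []} _ _ = s≤s z≤n
length≤1-if-allEqual {xs = _ ∷ _ ∷ _} ((a≢b ∷ _) ∷ _) allEqual =
  ⊥-elim (a≢b (allEqual (here refl) (there (here refl))))

∃∈-if-length≡1 : ∀ {A : Set} {xs : List A} → length xs ≡ 1 → ∃[ a ] (a ∈ xs)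
∃∈-if-length≡1 {xs = a ∷ _} _ = a , here refl

length-filter+filter-∁ : ∀ {A : Set} {P : Pred A 0ℓ} (P? : Decidable P) xs →
                         length (filter P? xs) + length (filter (∁? P?) xs) ≡ length xs
length-filter+filter-∁ P? [] = refl
length-filter+filter-∁ P? (a ∷ xs) with P? a
... | yes _ = cong suc (length-filter+filter-∁ P? xs)
... | no _ = trans (+-suc _ _) (cong suc (length-filter+filter-∁ P? xs))

+-saturated : ∀ {a b m n} → a ≤ m → b ≤ n → a + b ≡ m + n → a ≡ m × b ≡ n
+-saturated {a} {b} {n = n} a≤m b≤n eq with m≤n⇒m<n∨m≡n a≤m
... | inj₁ a<m = ⊥-elim (<-irrefl eq (+-mono-<-≤ a<m b≤n))
... | inj₂ refl = refl , +-cancelˡ-≡ a b n eq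

prefix? : (v x : Word) → Dec (∃[ s ] (v ++ s ≡ x))
prefix? [] x = yes (x , refl)
prefix? (a ∷ v) [] = no λ ()
prefix? (a ∷ v) (b ∷ x) with a ≟ b | prefix? v x
... | no a≢b | _ = no λ (s , eq) → a≢b (proj₁ (∷-injective eq))
... | yes refl | yes (s , eq) = yes (s , cong (a ∷_) eq)
... | yes refl | no ¬prefix = no λ (s , eq) → ¬prefix (s , proj₂ (∷-injective eq))

factor? : (v x : Word) → Dec (Factor v x)
factor? v x with prefix? v x
... | yes (s , eq) = yes ([] , s , eq)
factor? v [] | no ¬prefix = no λ { ([] , s , eq) → ¬prefix (s , eq) ; (_ ∷ _ , s , ()) }
factor? v (b ∷ x) | no ¬prefix with factor? v x
... | yes (p , s , eq) = yes (b ∷ p , s , cong (b ∷_) eq)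
... | no ¬factor = no λ { ([] , s , eq) → ¬prefix (s , eq)
                        ; (_ ∷ p , s , eq) → ¬factor (p , s , proj₂ (∷-injective eq)) }

palindrome? : (v : Word) → Dec (Palindrome v)
palindrome? v = ≡-dec _≟_ (reverse v) v

Suffix : Word → Word → Set
Suffix v x = ∃[ p ] (p ++ v ≡ x)

suffix⇒factor : ∀ {v x} → Suffix v x → Factor v x
suffix⇒factor {v} (p , eq) = p , [] , trans (cong (p ++_) (++-identityʳ v)) eq

suffix-∷ʳ : ∀ {v x} l → Suffix v x → Suffix (v ++ [ l ]) (x ++ [ l ])
suffix-∷ʳ {v} l (p , eq) = p , trans (sym (++-assoc p v [ l ])) (cong (_++ [ l ]) eq)

factor-++ʳ : ∀ {v x} y → Factor v x → Factor v (x ++ y)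
factor-++ʳ {v} y (p , s , eq) = p , s ++ y , (begin
  p ++ v ++ s ++ y     ≡⟨ cong (p ++_) (sym (++-assoc v s y)) ⟩
  p ++ (v ++ s) ++ y   ≡⟨ sym (++-assoc p (v ++ s) y) ⟩
  (p ++ v ++ s) ++ y   ≡⟨ cong (_++ y) eq ⟩
  _                    ∎)
  where open ≡-Reasoning

factor-trans : ∀ {u v w} → Factor u v → Factor v w → Factor u w
factor-trans {u} (p₁ , s₁ , refl) (p₂ , s₂ , refl) = p₂ ++ p₁ , s₁ ++ s₂ , (begin
  (p₂ ++ p₁) ++ u ++ s₁ ++ s₂   ≡⟨ ++-assoc p₂ p₁ (u ++ s₁ ++ s₂) ⟩
  p₂ ++ p₁ ++ u ++ s₁ ++ s₂     ≡⟨ cong (λ r → p₂ ++ p₁ ++ r) (sym (++-assoc u s₁ s₂)) ⟩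
  p₂ ++ p₁ ++ (u ++ s₁) ++ s₂   ≡⟨ cong (p₂ ++_) (sym (++-assoc p₁ (u ++ s₁) s₂)) ⟩
  p₂ ++ (p₁ ++ u ++ s₁) ++ s₂   ∎)
  where open ≡-Reasoning

factor-of-init : ∀ {v x l} p s e → p ++ v ++ s ++ [ e ] ≡ x ++ [ l ] → Factor v x
factor-of-init {v} {x} p s e eq = p , s , ∷ʳ-injectiveˡ (p ++ v ++ s) x (begin
  (p ++ v ++ s) ++ [ e ]   ≡⟨ ++-assoc p (v ++ s) [ e ] ⟩
  p ++ (v ++ s) ++ [ e ]   ≡⟨ cong (p ++_) (++-assoc v s [ e ]) ⟩
  p ++ v ++ s ++ [ e ]     ≡⟨ eq ⟩
  x ++ [ _ ]               ∎)
  where open ≡-Reasoning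

factor-∷ʳ⁻ : ∀ {v x l} → Factor v (x ++ [ l ]) → Factor v x ⊎ Suffix v (x ++ [ l ])
factor-∷ʳ⁻ {v} (p , s , eq) with initLast s
... | [] = inj₂ (p , trans (cong (p ++_) (sym (++-identityʳ v))) eq)
... | s′ ∷ʳ′ e = inj₁ (factor-of-init p s′ e eq)

factor-[] : ∀ {v} → Factor v [] → v ≡ []
factor-[] {[]} _ = refl
factor-[] {_ ∷ _} ([] , _ , ())
factor-[] {_ ∷ _} (_ ∷ _ , _ , ())

suffix-compare : ∀ p₁ {v₁} p₂ {v₂ : Word} → p₁ ++ v₁ ≡ p₂ ++ v₂ →
                 (∃[ t ] (v₁ ≡ t ++ v₂)) ⊎ (∃[ t ] (v₂ ≡ t ++ v₁))
suffix-compare [] p₂ eq = inj₁ (p₂ , eq)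
suffix-compare (a ∷ p₁) [] eq = inj₂ (a ∷ p₁ , sym eq)
suffix-compare (a ∷ p₁) (b ∷ p₂) eq = suffix-compare p₁ p₂ (proj₂ (∷-injective eq))

∈-tails : ∀ t {v z : Word} → t ++ v ≡ z → v ∈ tails z
∈-tails [] {[]} refl = here refl
∈-tails [] {_ ∷ _} refl = here refl
∈-tails (a ∷ t) refl = there (∈-tails t refl)

∈-inits : ∀ v {s z : Word} → v ++ s ≡ z → v ∈ inits z
∈-inits [] eq = here refl
∈-inits (a ∷ v) {s} refl = there (∈-map⁺ (a ∷_) (∈-inits v {s} refl))

factors : Word → List Word
factors z = concatMap inits (tails z)

∈-factors : ∀ {v z} → Factor v z → v ∈ factors z
∈-factors {v} (p , s , eq) = ∈-concatMap⁺ inits (lose (∈-tails p eq) (∈-inits v {s} refl))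

reverse-properSuffix-factor : ∀ {x l v} e t z → Palindrome v → Suffix v (x ++ [ l ]) →
                              v ≡ (e ∷ t) ++ z → Factor (reverse z) x
reverse-properSuffix-factor {x} {l} {v} e t z pal (p , p++v≡) v≡ =
  factor-of-init p (reverse t) e (begin
    p ++ reverse z ++ reverse t ++ [ e ]   ≡⟨ cong (λ r → p ++ reverse z ++ r) (sym (unfold-reverse e t)) ⟩
    p ++ reverse z ++ reverse (e ∷ t)      ≡⟨ cong (p ++_) (sym (reverse-++ (e ∷ t) z)) ⟩
    p ++ reverse ((e ∷ t) ++ z)            ≡⟨ cong (λ w → p ++ reverse w) (sym v≡) ⟩
    p ++ reverse v                         ≡⟨ cong (p ++_) pal ⟩
    p ++ v                                 ≡⟨ p++v≡ ⟩
    x ++ [ l ]                             ∎)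
  where open ≡-Reasoning

NewPalSuffix : Word → ℕ → Word → Set
NewPalSuffix x l v = Palindrome v × Suffix v (x ++ [ l ]) × ¬ Factor v x

newPalSuffix-vs-suffix : ∀ {x l v f} → NewPalSuffix x l v → Suffix f (x ++ [ l ]) →
                         v ∈ tails f ⊎ Factor (reverse f) x
newPalSuffix-vs-suffix {f = f} (pal , sufV@(p , p++v≡) , _) (q , q++f≡)
  with suffix-compare q p (trans q++f≡ (sym p++v≡))
... | inj₁ (t , f≡) = inj₁ (∈-tails t (sym f≡))
... | inj₂ ([] , v≡) = inj₁ (∈-tails [] v≡)
... | inj₂ (e ∷ t , v≡) = inj₂ (reverse-properSuffix-factor e t f pal sufV v≡)

newPalSuffix-notProperSuffix : ∀ {x l v w} t → NewPalSuffix x l v → NewPalSuffix x l w →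
                               v ≡ t ++ w → v ≡ w
newPalSuffix-notProperSuffix [] _ _ eq = eq
newPalSuffix-notProperSuffix {x} {w = w} (e ∷ t) (palV , sufV , _) (palW , _ , ¬w⊑x) eq =
  ⊥-elim (¬w⊑x (subst (λ r → Factor r x) palW (reverse-properSuffix-factor e t w palV sufV eq)))

newPalSuffix-unique : ∀ {x l v w} → NewPalSuffix x l v → NewPalSuffix x l w → v ≡ w
newPalSuffix-unique newV@(_ , (p , eV) , _) newW@(_ , (q , eW) , _)
  with suffix-compare p q (trans eV (sym eW))
... | inj₁ (t , eq) = newPalSuffix-notProperSuffix t newV newW eq
... | inj₂ (t , eq) = sym (newPalSuffix-notProperSuffix t newW newV eq)

PalindromicFactors : Word → List Word → Set
PalindromicFactors x L = ∀ {v} → v ∈ L → Factor v x × Palindrome v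

PalFactorsBounded : Word → Set
PalFactorsBounded x = ∀ L → Unique L → PalindromicFactors x L → length L ≤ length x + 1

module NewPalindromes (x : Word) (l : ℕ) {L : List Word}
                      (uniq : Unique L) (palL : PalindromicFactors (x ++ [ l ]) L) where

  isOld : Decidable (λ v → Factor v x)
  isOld v = factor? v x

  old new : List Word
  old = filter isOld L
  new = filter (∁? isOld) L

  old-unique : Unique old
  old-unique = filter⁺ isOld uniq

  old-palindromic : PalindromicFactors x old
  old-palindromic v∈ with ∈-filter⁻ isOld v∈
  ... | v∈L , v⊑x = v⊑x , proj₂ (palL v∈L)

  new-newPalSuffix : ∀ {v} → v ∈ new → NewPalSuffix x l v
  new-newPalSuffix v∈ with ∈-filter⁻ (∁? isOld) v∈
  ... | v∈L , ¬v⊑x with palL v∈L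
  ... | v⊑xl , pal with factor-∷ʳ⁻ v⊑xl
  ...   | inj₁ v⊑x = ⊥-elim (¬v⊑x v⊑x)
  ...   | inj₂ suf = pal , suf , ¬v⊑x

  length-new≤1 : length new ≤ 1
  length-new≤1 = length≤1-if-allEqual (filter⁺ (∁? isOld) uniq)
    (λ v∈ w∈ → newPalSuffix-unique (new-newPalSuffix v∈) (new-newPalSuffix w∈))

  length-old+new : length old + length new ≡ length L
  length-old+new = length-filter+filter-∁ isOld L

palFactorsBounded : ∀ x → PalFactorsBounded x
palFactorsBounded x = bounded (reverseView x)
  where
  bounded : ∀ {x} → Reverse x → PalFactorsBounded x
  bounded [] L uniq palL = length≤1-if-allEqual uniq λ v∈ w∈ →
    trans (factor-[] (proj₁ (palL v∈))) (sym (factor-[] (proj₁ (palL w∈))))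
  bounded (x ∶ rx ∶ʳ l) L uniq palL = begin
    length L                  ≡⟨ length-old+new ⟨
    length old + length new   ≤⟨ +-mono-≤ (bounded rx old old-unique old-palindromic) length-new≤1 ⟩
    length x + 1 + 1          ≡⟨ cong (_+ 1) (length-++ x) ⟨
    length (x ++ [ l ]) + 1   ∎
    where
    open NewPalindromes x l uniq palL
    open ≤-Reasoning

module RichExtension {x : Word} {l : ℕ} (rich : Rich (x ++ [ l ])) where

  L : List Word
  L = proj₁ rich

  L-palindromes : ∀ v → (v ∈ L) ⇔ (Factor v (x ++ [ l ]) × Palindrome v)
  L-palindromes = proj₁ (proj₂ (proj₂ rich))

  open NewPalindromes x l (proj₁ (proj₂ rich)) (Equivalence.to (L-palindromes _)) public

  saturated : length old ≡ length x + 1 × length new ≡ 1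
  saturated = +-saturated (palFactorsBounded x old old-unique old-palindromic) length-new≤1 (begin
    length old + length new   ≡⟨ length-old+new ⟩
    length L                  ≡⟨ proj₂ (proj₂ (proj₂ rich)) ⟩
    length (x ++ [ l ]) + 1   ≡⟨ cong (_+ 1) (length-++ x) ⟩
    length x + 1 + 1          ∎)
    where open ≡-Reasoning

rich-init : ∀ {x l} → Rich (x ++ [ l ]) → Rich x
rich-init {x} {l} rich = old , old-unique , (λ v → mk⇔ old-palindromic (old-complete v)) , proj₁ saturated
  where
  open RichExtension rich
  old-complete : ∀ v → Factor v x × Palindrome v → v ∈ old
  old-complete v (v⊑x , pal) =
    ∈-filter⁺ isOld (Equivalence.from (L-palindromes v) (factor-++ʳ [ l ] v⊑x , pal)) v⊑x

rich-prefix : ∀ x y → Rich (x ++ y) → Rich x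
rich-prefix x [] rich = subst Rich (++-identityʳ x) rich
rich-prefix x (l ∷ y) rich =
  rich-init (rich-prefix (x ++ [ l ]) y (subst Rich (sym (++-assoc x [ l ] y)) rich))

rich-∷ʳ-newPalSuffix : ∀ {x l} → Rich (x ++ [ l ]) → ∃ (NewPalSuffix x l)
rich-∷ʳ-newPalSuffix rich = map₂ new-newPalSuffix (∃∈-if-length≡1 (proj₂ saturated))
  where open RichExtension rich

module ForbiddenFactors (w : Word) (F : List Word)
         (F-palSuffixes⊑w : All (λ f → All (λ v → Palindrome v → Factor v w) (tails f)) F)
         (F-reverse-closed : All (λ f → reverse f ∈ F) F) where

  Avoids : Word → Set
  Avoids x = All (λ f → ¬ Factor f x) F

  avoids? : ∀ x → Dec (Avoids x)
  avoids? x = all? (λ f → ¬? (factor? f x)) F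

  avoids-factor : ∀ {y x} → Factor y x → Avoids x → Avoids y
  avoids-factor y⊑x = All.map (λ ¬f⊑x f⊑y → ¬f⊑x (factor-trans f⊑y y⊑x))

  avoids-∷ʳ : ∀ {x l} → Factor w x → Avoids x → Rich (x ++ [ l ]) → Avoids (x ++ [ l ])
  avoids-∷ʳ {x} {l} w⊑x avoids rich = All.tabulate avoid
    where
    avoid : ∀ {f} → f ∈ F → ¬ Factor f (x ++ [ l ])
    avoid f∈ f⊑xl with factor-∷ʳ⁻ f⊑xl | rich-∷ʳ-newPalSuffix rich
    ... | inj₁ f⊑x | _ = All.lookup avoids f∈ f⊑x
    ... | inj₂ suf | v , newV@(pal , _ , ¬v⊑x) with newPalSuffix-vs-suffix newV suf
    ...   | inj₁ v∈ = ¬v⊑x (factor-trans (All.lookup (All.lookup F-palSuffixes⊑w f∈) v∈ pal) w⊑x)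
    ...   | inj₂ rf⊑x = All.lookup avoids (All.lookup F-reverse-closed f∈) rf⊑x

  avoids-++ : ∀ {x} u → Factor w x → Avoids x → Rich (x ++ u) → Avoids (x ++ u)
  avoids-++ {x} [] _ avoids _ = subst Avoids (sym (++-identityʳ x)) avoids
  avoids-++ {x} (l ∷ u) w⊑x avoids rich = subst Avoids (++-assoc x [ l ] u)
      (avoids-++ u (factor-++ʳ [ l ] w⊑x) (avoids-∷ʳ w⊑x avoids (rich-prefix (x ++ [ l ]) u rich′))
                 rich′)
    where
    rich′ : Rich ((x ++ [ l ]) ++ u)
    rich′ = subst Rich (sym (++-assoc x [ l ] u)) rich

w₀ : Word
w₀ = 0 ∷ 0 ∷ 1 ∷ 0 ∷ 1 ∷ 1 ∷ 0 ∷ 2 ∷ []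

w₀-palindromes : List Word
w₀-palindromes = [] ∷ (0 ∷ []) ∷ (1 ∷ []) ∷ (2 ∷ []) ∷ (0 ∷ 0 ∷ []) ∷ (1 ∷ 1 ∷ []) ∷
                 (0 ∷ 1 ∷ 0 ∷ []) ∷ (1 ∷ 0 ∷ 1 ∷ []) ∷ (0 ∷ 1 ∷ 1 ∷ 0 ∷ []) ∷ []

w₀-rich : Rich w₀
w₀-rich = w₀-palindromes , from-yes (unique? w₀-palindromes) , palindromes , refl
  where
  sound : All (λ v → Factor v w₀ × Palindrome v) w₀-palindromes
  sound = from-yes (all? (λ v → factor? v w₀ ×-dec palindrome? v) w₀-palindromes)
  complete : All (λ v → Palindrome v → v ∈ w₀-palindromes) (factors w₀)
  complete = from-yes (all? (λ v → palindrome? v →-dec v ∈? w₀-palindromes) (factors w₀))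
  palindromes : ∀ v → (v ∈ w₀-palindromes) ⇔ (Factor v w₀ × Palindrome v)
  palindromes v = mk⇔ (All.lookup sound) λ (v⊑w₀ , pal) → All.lookup complete (∈-factors v⊑w₀) pal

forbidden : List Word
forbidden = (1 ∷ 2 ∷ []) ∷ (2 ∷ 1 ∷ []) ∷ (0 ∷ 0 ∷ 2 ∷ []) ∷ (2 ∷ 0 ∷ 0 ∷ []) ∷
            (0 ∷ 0 ∷ 1 ∷ 1 ∷ []) ∷ (1 ∷ 1 ∷ 0 ∷ 0 ∷ []) ∷
            (0 ∷ 1 ∷ 0 ∷ 2 ∷ []) ∷ (2 ∷ 0 ∷ 1 ∷ 0 ∷ []) ∷ []

forbidden-palSuffixes⊑w₀ : All (λ f → All (λ v → Palindrome v → Factor v w₀) (tails f)) forbidden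
forbidden-palSuffixes⊑w₀ =
  from-yes (all? (λ f → all? (λ v → palindrome? v →-dec factor? v w₀) (tails f)) forbidden)

forbidden-reverse-closed : All (λ f → reverse f ∈ forbidden) forbidden
forbidden-reverse-closed = from-yes (all? (λ f → reverse f ∈? forbidden) forbidden)

open ForbiddenFactors w₀ forbidden forbidden-palSuffixes⊑w₀ forbidden-reverse-closed

-- What a rich step xl forces on the last letters s of x: the new palindromic suffix
-- either lies within sl, or is longer and then starts with the reversal of sl.
RichStepAfter : Word → ℕ → Set
RichStepAfter s l = Any (λ v → Palindrome v × ¬ Factor v w₀ × ¬ Factor v s) (tails (s ++ [ l ]))
                  ⊎ Avoids (reverse (s ++ [ l ]))

richStepAfter? : ∀ s l → Dec (RichStepAfter s l)
richStepAfter? s l =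
  any? (λ v → palindrome? v ×-dec ¬? (factor? v w₀) ×-dec ¬? (factor? v s)) (tails (s ++ [ l ]))
  ⊎-dec avoids? (reverse (s ++ [ l ]))

rich-∷ʳ⇒richStepAfter : ∀ {x s l} → Factor w₀ x → Avoids x → Suffix s x → Rich (x ++ [ l ]) →
                         RichStepAfter s l
rich-∷ʳ⇒richStepAfter {l = l} w₀⊑x avoids s-suf rich with rich-∷ʳ-newPalSuffix rich
... | v , newV@(pal , _ , ¬v⊑x) with newPalSuffix-vs-suffix newV (suffix-∷ʳ l s-suf)
...   | inj₁ v∈ = inj₁ (lose v∈ (pal , (λ v⊑w₀ → ¬v⊑x (factor-trans v⊑w₀ w₀⊑x))
                                       , (λ v⊑s → ¬v⊑x (factor-trans v⊑s (suffix⇒factor s-suf)))))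
...   | inj₂ rsl⊑x = inj₂ (avoids-factor rsl⊑x avoids)

ViableEnding : Word → Set
ViableEnding s = Avoids s × All (RichStepAfter s) (Alph w₀)

noViableEnding :
  All (λ a → All (λ b → All (λ c → ¬ ViableEnding (a ∷ b ∷ c ∷ [])) (Alph w₀)) (Alph w₀)) (Alph w₀)
noViableEnding = from-yes (all? (λ a → all? (λ b → all? (λ c → ¬? (viable? (a ∷ b ∷ c ∷ []))) A) A) A)
  where
  A : List ℕ
  A = Alph w₀
  viable? : ∀ s → Dec (ViableEnding s)
  viable? s = avoids? s ×-dec all? (richStepAfter? s) A

w₀-letters : All (_∈ Alph w₀) w₀
w₀-letters = from-yes (all? (_∈ℕ? Alph w₀) w₀)

split-last-three : ∀ (a b c : ℕ) y →
                   ∃[ p ] ∃[ a′ ] ∃[ b′ ] ∃[ c′ ] (a ∷ b ∷ c ∷ y ≡ p ++ a′ ∷ b′ ∷ c′ ∷ [])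
split-last-three a b c [] = [] , a , b , c , refl
split-last-three a b c (d ∷ y) with split-last-three b c d y
... | p , a′ , b′ , c′ , eq = a ∷ p , a′ , b′ , c′ , cong (a ∷_) eq

w₀-notEventuallyExtensible : ∀ u → All (_∈ Alph w₀) u → Rich (w₀ ++ u) →
                             ¬ (∀ a → a ∈ Alph w₀ → Rich ((w₀ ++ u) ++ [ a ]))
w₀-notEventuallyExtensible u u⊆ rich richExt with split-last-three 0 0 1 (0 ∷ 1 ∷ 1 ∷ 0 ∷ 2 ∷ u)
... | p , a , b , c , x≡ with ++⁻ʳ p (subst (All (_∈ Alph w₀)) x≡ (++⁺ w₀-letters u⊆))
... | a∈ ∷ b∈ ∷ c∈ ∷ [] = All.lookup (All.lookup (All.lookup noViableEnding a∈) b∈) c∈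
        ( avoids-factor (suffix⇒factor s-suf) avoids
        , All.tabulate λ {l} l∈ → rich-∷ʳ⇒richStepAfter w₀⊑x avoids s-suf (richExt l l∈))
  where
  w₀⊑x : Factor w₀ (w₀ ++ u)
  w₀⊑x = [] , u , refl
  avoids : Avoids (w₀ ++ u)
  avoids = avoids-++ u ([] , [] , ++-identityʳ w₀) (from-yes (avoids? w₀)) rich
  s-suf : Suffix (a ∷ b ∷ c ∷ []) (w₀ ++ u)
  s-suf = p , sym x≡

mainTheorem3 : ∃[ w ] (Rich w × length (Alph w) ≡ 3 ×
                 ¬ (∃[ u ] (All (λ a → a ∈ Alph w) u × Rich (w ++ u) ×
                      (∀ a → a ∈ Alph w → Rich ((w ++ u) ++ [ a ])))))
mainTheorem3 = w₀ , w₀-rich , refl ,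
  λ (u , u⊆ , rich , richExt) → w₀-notEventuallyExtensible u u⊆ rich richExt
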